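{- Let $G=(A,B,E)$ be a bipartite graph, $A'\subseteq A$, $\varnothing\ne A''\subseteq A'$, and let $S=\mathrm{semi}(A',B,E)$. Let $\Gamma_S(A')=\{b_1,\dots,b_k\}$, and for each $b_i\in\Gamma_S(A')$ let $A'_i=\Gamma_S(b_i)\cap A'$ and $A''_i=\Gamma_S(b_i)\cap A''$. Then $$\big(\operatorname{deg}_{\max}\mathrm{semi}(A'',B,E)\big)^{ -1}\sum_{i:\,b_i\in\Gamma_S(A'')}|A''_i|\,(|A'_i|-1)\le|A'|.$$
   Context: $\Gamma_F(X)$ is the set of neighbors of vertices of $X$ in the graph with edge set $F$. $\deg_F(v)$ is the number of edges of $F$ at $v$; $\operatorname{deg}_{\max}F=\max_v\deg_F(v)$. For $X\subseteq A$, a semi-matching of $(X,B,E)$ is a set $T$ of edges of $E$ between $X$ and $B$ with $\deg_T(a)=1$ for all $a\in X$; a degree-minimizing path with respect to $T$ is a path $b_1,a_1,b_2,\dots,a_{k-1},b_k$ ($a_i\in X$) with $(a_i,b_i)\in T$, $(a_i,b_{i+1})\in E\setminus T$, $\deg_T(b_1)\ge\deg_T(b_k)+2$; $\mathrm{semi}(X,B,E)$ denotes an optimal semi-matching (none such path), all of which share the same, minimum possible, maximum degree. It is assumed each vertex of $A'$ has a neighbor. -}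

module Defs where

open import Data.Nat using (ℕ; zero; suc; _+_; _⊔_; _≥_)
open import Data.Bool using (Bool; true; false; if_then_else_; _∧_; _∨_)
open import Data.Fin using (Fin; zero; suc; inject₁; fromℕ)
open import Data.Product using (_×_)
open import Function using (_∘_)
open import Function.Definitions using (Injective)
open import Relation.Binary.PropositionalEquality using (_≡_)
open import Relation.Nullary using (¬_)

-- A bipartite graph (A,B,E) has A = Fin m, B = Fin n, and an edge set
-- is a Boolean matrix.  Vertex subsets are Boolean predicates.
EdgeSet : ℕ → ℕ → Set
EdgeSet m n = Fin m → Fin n → Bool

VSet : ℕ → Set
VSet k = Fin k → Bool

sumF : ∀ {k} → (Fin k → ℕ) → ℕ
sumF {zero} f = 0
sumF {suc k} f = f zero + sumF (f ∘ suc)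

count : ∀ {k} → VSet k → ℕ
count p = sumF (λ i → if p i then 1 else 0)

maxF : ∀ {k} → (Fin k → ℕ) → ℕ
maxF {zero} f = 0
maxF {suc k} f = f zero ⊔ maxF (f ∘ suc)

anyF : ∀ {k} → VSet k → Bool
anyF {zero} p = false
anyF {suc k} p = p zero ∨ anyF (p ∘ suc)

degA : ∀ {m n} → EdgeSet m n → Fin m → ℕ
degA F a = count (F a)

degB : ∀ {m n} → EdgeSet m n → Fin n → ℕ
degB F b = count (λ a → F a b)

degmax : ∀ {m n} → EdgeSet m n → ℕ
degmax F = maxF (degA F) ⊔ maxF (degB F)

Γ : ∀ {m n} → EdgeSet m n → VSet m → VSet n
Γ F X b = anyF (λ a → X a ∧ F a b)

IsSemiMatching : ∀ {m n} → VSet m → EdgeSet m n → EdgeSet m n → Set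
IsSemiMatching X E T =
  (∀ a b → T a b ≡ true → (E a b ≡ true × X a ≡ true)) ×
  (∀ a → X a ≡ true → degA T a ≡ 1)

-- A degree-minimizing path b_1,a_1,b_2,…,a_{k-1},b_k w.r.t. T.
-- Here len = k-1; bs : Fin (suc len) gives b_1..b_k, as : Fin len gives a_1..a_{k-1}.
record DegMinPath {m n} (X : VSet m) (E T : EdgeSet m n) : Set where
  field
    len   : ℕ
    bs    : Fin (suc len) → Fin n
    as    : Fin len → Fin m
    bs-inj : Injective _≡_ _≡_ bs
    as-inj : Injective _≡_ _≡_ as
    as-X  : ∀ i → X (as i) ≡ true
    inT   : ∀ i → T (as i) (bs (inject₁ i)) ≡ true
    inE   : ∀ i → E (as i) (bs (suc i)) ≡ true
    notT  : ∀ i → T (as i) (bs (suc i)) ≡ false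
    degOK : degB T (bs zero) ≥ degB T (bs (fromℕ len)) + 2

IsOptimalSemi : ∀ {m n} → VSet m → EdgeSet m n → EdgeSet m n → Set
IsOptimalSemi X E T = IsSemiMatching X E T × ¬ DegMinPath X E T

-- Double counting: Σ_b |A''_b| (|A'_b| − 1) = Σ_{a ∈ A''} (|A'_σ(a)| − 1), where σ(a) is the
-- S-partner of a.  If τ(a) is the partner of a in semi(A'',B,E) and τ(a) ≠ σ(a), then
-- σ(a), a, τ(a) is a path of length one, which optimality of S forbids from being
-- degree-minimizing; hence |A'_σ(a)| − 1 ≤ |A'_τ(a)|.  Counting by τ instead, the sum is at
-- most Σ_b |Γ_{semi(A'')}(b) ∩ A''| · |A'_b| ≤ deg_max semi(A'') · |A'|.
module Submission where

open import Defs
open import Data.Nat using (ℕ; zero; suc; _+_; _*_; _∸_; _≤_; _≤?_; z≤n)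
open import Data.Nat.Properties
open import Data.Bool using (Bool; true; false; if_then_else_; _∧_)
open import Data.Bool.Properties using (¬-not; ∧-identityʳ; ∧-zeroʳ)
open import Data.Fin using (Fin; zero; suc)
import Data.Fin.Properties as Fin
open import Data.Product using (∃; ∃-syntax; _×_; _,_; proj₁; proj₂)
open import Function using (_∘_; flip)
open import Relation.Nullary using (¬_; yes; no; contradiction)
open import Relation.Binary.PropositionalEquality
  using (_≡_; _≢_; refl; sym; trans; cong; subst; module ≡-Reasoning)
open import Algebra.Properties.CommutativeMonoid.Sum +-0-commutativeMonoid
  using (sum; sum-cong-≗; sum-replicate-zero; ∑-comm)
open import Algebra.Properties.Semiring.Sum +-*-semiring using (*-distribˡ-sum)

sumF≡sum : ∀ {k} (f : Fin k → ℕ) → sumF f ≡ sum f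
sumF≡sum {zero}  f = refl
sumF≡sum {suc k} f = cong (f zero +_) (sumF≡sum (f ∘ suc))

sumF-cong : ∀ {k} {f g : Fin k → ℕ} → (∀ i → f i ≡ g i) → sumF f ≡ sumF g
sumF-cong {f = f} {g} f≗g =
  trans (sumF≡sum f) (trans (sum-cong-≗ f≗g) (sym (sumF≡sum g)))

sumF-mono : ∀ {k} {f g : Fin k → ℕ} → (∀ i → f i ≤ g i) → sumF f ≤ sumF g
sumF-mono {zero}  f≤g = z≤n
sumF-mono {suc k} f≤g = +-mono-≤ (f≤g zero) (sumF-mono (f≤g ∘ suc))

sumF-comm : ∀ {k l} (f : Fin k → Fin l → ℕ) →
  sumF (λ i → sumF (f i)) ≡ sumF (λ j → sumF (λ i → f i j))
sumF-comm f = trans (sumF²≡sum² f) (trans (∑-comm f) (sym (sumF²≡sum² (flip f))))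
  where
  sumF²≡sum² : ∀ {k l} (g : Fin k → Fin l → ℕ) →
    sumF (λ i → sumF (g i)) ≡ sum (λ i → sum (g i))
  sumF²≡sum² g = trans (sumF≡sum (λ i → sumF (g i))) (sum-cong-≗ (sumF≡sum ∘ g))

*-distribˡ-sumF : ∀ {k} x (f : Fin k → ℕ) → x * sumF f ≡ sumF (λ i → x * f i)
*-distribˡ-sumF x f = begin
  x * sumF f              ≡⟨ cong (x *_) (sumF≡sum f) ⟩
  x * sum f               ≡⟨ *-distribˡ-sum x f ⟩
  sum (λ i → x * f i)     ≡⟨ sumF≡sum (λ i → x * f i) ⟨
  sumF (λ i → x * f i)    ∎
  where open ≡-Reasoning

if-then-else-0≤ : ∀ b x → (if b then x else 0) ≤ x
if-then-else-0≤ true  x = ≤-refl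
if-then-else-0≤ false x = z≤n

count-*ʳ : ∀ {k} (p : VSet k) x → count p * x ≡ sumF (λ i → if p i then x else 0)
count-*ʳ p x = trans (*-comm (count p) x)
  (trans (*-distribˡ-sumF x (λ i → if p i then 1 else 0)) (sumF-cong (*-indicator ∘ p)))
  where
  *-indicator : ∀ b → x * (if b then 1 else 0) ≡ (if b then x else 0)
  *-indicator true  = *-identityʳ x
  *-indicator false = *-zeroʳ x

count-∧-≤ʳ : ∀ {k} (p q : VSet k) → count (λ i → p i ∧ q i) ≤ count q
count-∧-≤ʳ p q = sumF-mono (λ i → indicator-≤ (p i) (q i))
  where
  indicator-≤ : ∀ b c → (if b ∧ c then 1 else 0) ≤ (if c then 1 else 0)
  indicator-≤ true  c = ≤-refl
  indicator-≤ false c = z≤n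

count≡0⇒≡false : ∀ {k} (p : VSet k) → count p ≡ 0 → ∀ i → p i ≡ false
count≡0⇒≡false {suc k} p h i with p zero in e
count≡0⇒≡false {suc k} p h zero    | false = e
count≡0⇒≡false {suc k} p h (suc i) | false = count≡0⇒≡false (p ∘ suc) h i

count≡1⇒unique : ∀ {k} (p : VSet k) → count p ≡ 1 →
  ∃[ j ] (p j ≡ true × (∀ i → p i ≡ true → i ≡ j))
count≡1⇒unique {suc k} p h with p zero in e
... | true = zero , e , unique
  where
  unique : ∀ i → p i ≡ true → i ≡ zero
  unique zero    _  = refl
  unique (suc i) pi =
    contradiction (trans (sym pi) (count≡0⇒≡false (p ∘ suc) (suc-injective h) i)) λ ()
... | false with count≡1⇒unique (p ∘ suc) h
...   | j , pj , unique-suc = suc j , pj , unique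
  where
  unique : ∀ i → p i ≡ true → i ≡ suc j
  unique zero    p0 = contradiction (trans (sym p0) e) λ ()
  unique (suc i) pi = cong suc (unique-suc i pi)

sumF-if-false : ∀ {k} (p : VSet k) (f : Fin k → ℕ) → (∀ i → p i ≡ false) →
  sumF (λ i → if p i then f i else 0) ≡ 0
sumF-if-false {k} p f none =
  trans (sumF-cong (λ i → cong (λ b → if b then f i else 0) (none i)))
        (trans (sumF≡sum {k} (λ _ → 0)) (sum-replicate-zero k))

sumF-if-unique : ∀ {k} (p : VSet k) (f : Fin k → ℕ) {j} → p j ≡ true →
  (∀ i → p i ≡ true → i ≡ j) → sumF (λ i → if p i then f i else 0) ≡ f j
sumF-if-unique {suc k} p f {zero} pj unique rewrite pj =
  trans (cong (f zero +_) (sumF-if-false (p ∘ suc) (f ∘ suc) rest-false)) (+-identityʳ (f zero))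
  where
  rest-false : ∀ i → p (suc i) ≡ false
  rest-false i = ¬-not (Fin.0≢1+n ∘ sym ∘ unique (suc i))
sumF-if-unique {suc k} p f {suc j} pj unique
  rewrite ¬-not {p zero} (Fin.0≢1+n ∘ unique zero) =
  sumF-if-unique (p ∘ suc) (f ∘ suc) pj (λ i → Fin.suc-injective ∘ unique (suc i))

double-counting : ∀ {k l} (R : Fin k → Fin l → Bool) (w : Fin l → ℕ) →
  sumF (λ j → count (λ i → R i j) * w j) ≡
  sumF (λ i → sumF (λ j → if R i j then w j else 0))
double-counting R w = trans (sumF-cong (λ j → count-*ʳ (λ i → R i j) (w j)))
                            (sym (sumF-comm (λ i j → if R i j then w j else 0)))

f≤maxF : ∀ {k} (f : Fin k → ℕ) i → f i ≤ maxF f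
f≤maxF f zero    = m≤m⊔n _ _
f≤maxF f (suc i) = ≤-trans (f≤maxF (f ∘ suc) i) (m≤n⊔m _ _)

degB≤degmax : ∀ {m n} (T : EdgeSet m n) b → degB T b ≤ degmax T
degB≤degmax T b = ≤-trans (f≤maxF (degB T) b) (m≤n⊔m _ _)

module _ {m n} {X : VSet m} {E T : EdgeSet m n} (semi : IsSemiMatching X E T) where

  private
    edge⇒X : ∀ {a b} → T a b ≡ true → X a ≡ true
    edge⇒X {a} {b} = proj₂ ∘ proj₁ semi a b

  semiMatching-degB : ∀ b → degB T b ≡ count (λ a → X a ∧ T a b)
  semiMatching-degB b = sumF-cong (λ a → cong (λ c → if c then 1 else 0) (T≡X∧T a))
    where
    T≡X∧T : ∀ a → T a b ≡ X a ∧ T a b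
    T≡X∧T a with T a b in e
    ... | true  = sym (trans (∧-identityʳ (X a)) (edge⇒X e))
    ... | false = sym (∧-zeroʳ (X a))

  semiMatching-degA : ∀ a → degA T a ≡ (if X a then 1 else 0)
  semiMatching-degA a with X a in e
  ... | true  = proj₂ semi a e
  ... | false = sumF-if-false (T a) (λ _ → 1) (λ b → ¬-not (no-edge b))
    where
    no-edge : ∀ b → T a b ≢ true
    no-edge b t = contradiction (trans (sym e) (edge⇒X t)) λ ()

  semiMatching-sumF-degB : sumF (degB T) ≡ count X
  semiMatching-sumF-degB =
    trans (sym (sumF-comm (λ a b → if T a b then 1 else 0))) (sumF-cong semiMatching-degA)

¬DegMinPath⇒degB∸1≤degB : ∀ {m n} {X : VSet m} {E T : EdgeSet m n} {a σ τ} →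
  ¬ DegMinPath X E T → X a ≡ true → T a σ ≡ true → E a τ ≡ true → T a τ ≡ false →
  degB T σ ∸ 1 ≤ degB T τ
¬DegMinPath⇒degB∸1≤degB {n = n} {X = X} {E} {T} {a} {σ} {τ} noPath Xa Taσ Eaτ Taτ
  with degB T σ ≤? 1 + degB T τ
... | yes σ≤1+τ = m≤n+o⇒m∸n≤o (degB T σ) 1 σ≤1+τ
... | no  σ≰1+τ = contradiction path noPath
  where
  σ≢τ : σ ≢ τ
  σ≢τ refl = contradiction (trans (sym Taσ) Taτ) λ ()

  bs : Fin 2 → Fin n
  bs zero       = σ
  bs (suc zero) = τ

  bs-injective : ∀ {i j} → bs i ≡ bs j → i ≡ j
  bs-injective {zero}     {zero}     _  = refl
  bs-injective {zero}     {suc zero} eq = contradiction eq σ≢τ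
  bs-injective {suc zero} {zero}     eq = contradiction (sym eq) σ≢τ
  bs-injective {suc zero} {suc zero} _  = refl

  path : DegMinPath X E T
  path = record
    { len = 1 ; bs = bs ; as = λ _ → a
    ; bs-inj = bs-injective ; as-inj = λ { {zero} {zero} _ → refl }
    ; as-X = λ _ → Xa
    ; inT = λ { zero → Taσ } ; inE = λ { zero → Eaτ } ; notT = λ { zero → Taτ }
    ; degOK = subst (_≤ degB T σ) (+-comm 2 (degB T τ)) (≰⇒> σ≰1+τ)
    }

optimal-reassign-≤ : ∀ {m n} {X : VSet m} {E S T : EdgeSet m n} {a} →
  IsOptimalSemi X E S → X a ≡ true →
  degA T a ≡ 1 → (∀ b → T a b ≡ true → E a b ≡ true) →
  sumF (λ b → if S a b then degB S b ∸ 1 else 0) ≤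
  sumF (λ b → if T a b then degB S b else 0)
optimal-reassign-≤ {S = S} {T} {a} ((_ , S-deg) , noPath) Xa Ta-deg Ta⊆E
  with count≡1⇒unique (S a) (S-deg a Xa) | count≡1⇒unique (T a) Ta-deg
... | σ , Saσ , σ-unique | τ , Taτ , τ-unique = begin
  sumF (λ b → if S a b then degB S b ∸ 1 else 0)
    ≡⟨ sumF-if-unique (S a) (λ b → degB S b ∸ 1) Saσ σ-unique ⟩
  degB S σ ∸ 1
    ≤⟨ partner-bound (S a τ) refl ⟩
  degB S τ
    ≡⟨ sumF-if-unique (T a) (degB S) Taτ τ-unique ⟨
  sumF (λ b → if T a b then degB S b else 0) ∎
  where
  open ≤-Reasoning
  partner-bound : ∀ c → S a τ ≡ c → degB S σ ∸ 1 ≤ degB S τ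
  partner-bound true  Saτ rewrite σ-unique τ Saτ = m∸n≤m (degB S σ) 1
  partner-bound false Saτ = ¬DegMinPath⇒degB∸1≤degB noPath Xa Saσ (Ta⊆E τ Taτ) Saτ

-- The two nonemptiness hypotheses are unused: they only make the paper's division
-- by deg_max semi(A'',B,E) meaningful, and the multiplied-out form holds without them.
lemma6 : ∀ {m n} (E : EdgeSet m n) (A' A'' : VSet m) →
    (∀ a → A'' a ≡ true → A' a ≡ true) →
    (∃ λ a → A'' a ≡ true) →
    (∀ a → A' a ≡ true → ∃ λ b → E a b ≡ true) →
    (S S'' : EdgeSet m n) →
    IsOptimalSemi A' E S →
    IsOptimalSemi A'' E S'' →
    sumF (λ b → if Γ S A'' b
                  then count (λ a → A'' a ∧ S a b) * (count (λ a → A' a ∧ S a b) ∸ 1)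
                  else 0)
      ≤ count A' * degmax S''
lemma6 E A' A'' A''⊆A' _ _ S S'' S-optimal@(S-semi , _) ((S''-sound , S''-deg) , _) = begin
  sumF (λ b → if Γ S A'' b then in-A'' S b * (in-A' b ∸ 1) else 0)
    ≤⟨ sumF-mono (λ b → if-then-else-0≤ (Γ S A'' b) _) ⟩
  sumF (λ b → in-A'' S b * (in-A' b ∸ 1))
    ≡⟨ sumF-cong (λ b → cong (λ d → in-A'' S b * (d ∸ 1)) (semiMatching-degB S-semi b)) ⟨
  sumF (λ b → in-A'' S b * (degB S b ∸ 1))
    ≡⟨ double-counting (λ a b → A'' a ∧ S a b) (λ b → degB S b ∸ 1) ⟩
  sumF (λ a → sumF (λ b → if A'' a ∧ S a b then degB S b ∸ 1 else 0))
    ≤⟨ sumF-mono reassign ⟩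
  sumF (λ a → sumF (λ b → if A'' a ∧ S'' a b then degB S b else 0))
    ≡⟨ double-counting (λ a b → A'' a ∧ S'' a b) (degB S) ⟨
  sumF (λ b → in-A'' S'' b * degB S b)
    ≤⟨ sumF-mono (λ b → *-monoˡ-≤ (degB S b) (in-A''≤degmax b)) ⟩
  sumF (λ b → degmax S'' * degB S b)
    ≡⟨ *-distribˡ-sumF (degmax S'') (degB S) ⟨
  degmax S'' * sumF (degB S)
    ≡⟨ cong (degmax S'' *_) (semiMatching-sumF-degB S-semi) ⟩
  degmax S'' * count A'
    ≡⟨ *-comm (degmax S'') (count A') ⟩
  count A' * degmax S'' ∎
  where
  open ≤-Reasoning
  in-A'' : EdgeSet _ _ → Fin _ → ℕ
  in-A'' T b = count (λ a → A'' a ∧ T a b)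
  in-A' : Fin _ → ℕ
  in-A' b = count (λ a → A' a ∧ S a b)

  in-A''≤degmax : ∀ b → in-A'' S'' b ≤ degmax S''
  in-A''≤degmax b = ≤-trans (count-∧-≤ʳ A'' (λ a → S'' a b)) (degB≤degmax S'' b)

  reassign : ∀ a → sumF (λ b → if A'' a ∧ S a b then degB S b ∸ 1 else 0)
                 ≤ sumF (λ b → if A'' a ∧ S'' a b then degB S b else 0)
  reassign a with A'' a in e
  ... | false = ≤-refl
  ... | true  = optimal-reassign-≤ {T = S''} S-optimal (A''⊆A' a e) (S''-deg a e)
                                   (λ b → proj₁ ∘ S''-sound a b)
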